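{- The set $\{F_n:n\ge0\}$ of Fibonacci numbers is definable in the structure $\langle\mathbb{Z},<,+,f,0\rangle$ by a $\Pi_1$ formula of the language $\{<,+,f,0\}$ (without parameters).
   Context: $\varphi=(1+\sqrt5)/2$ and $f(x)=\lfloor\varphi x\rfloor$ for $x\in\mathbb{Z}$. Fibonacci numbers: $F_0=F_1=1$, $F_{n+2}=F_n+F_{n+1}$. -}

module Defs where

open import Data.Nat as ℕ using (ℕ; zero; suc)
open import Data.Integer as ℤ using (ℤ; +_; -[1+_])
open import Data.Fin using (Fin)
open import Data.Vec.Functional using (Vector; _∷_)
open import Data.Product using (Σ; _×_)
open import Data.Sum using (_⊎_)
open import Data.Bool using (if_then_else_)
open import Relation.Nullary using (¬_)
open import Relation.Binary.PropositionalEquality using (_≡_)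

fib : ℕ → ℕ
fib zero = 1
fib (suc zero) = 1
fib (suc (suc n)) = fib n ℕ.+ fib (suc n)

IsFib : ℤ → Set
IsFib z = Σ ℕ λ n → z ≡ + fib n

isqrt-step : ℕ → ℕ → ℕ
isqrt-step n r = if (suc r ℕ.* suc r) ℕ.≤ᵇ n then suc r else r

isqrt : ℕ → ℕ
isqrt zero = zero
isqrt (suc n) = isqrt-step (suc n) (isqrt n)

-- f x = ⌊ φ x ⌋ with φ = (1 + √5)/2.
-- With a = |x| and s = ⌊ a √5 ⌋ = isqrt (5 a²):
--   x ≥ 0 : ⌊ φ x ⌋ = ⌊ (a + s) / 2 ⌋
--   x < 0 : ⌊ x √5 ⌋ = -(s+1) (√5 irrational), so ⌊ φ x ⌋ = ⌊ -(a+s+1)/2 ⌋ = -⌈(a+s+1)/2⌉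
f : ℤ → ℤ
f (+ a) = + ((a ℕ.+ isqrt (5 ℕ.* (a ℕ.* a))) ℕ./ 2)
f (-[1+ k ]) =
  let a = suc k in
  ℤ.- (+ ((a ℕ.+ isqrt (5 ℕ.* (a ℕ.* a)) ℕ.+ 2) ℕ./ 2))

data Term (n : ℕ) : Set where
  var  : Fin n → Term n
  zer  : Term n
  plus : Term n → Term n → Term n
  fₜ   : Term n → Term n

data Formula : ℕ → Set where
  _≐_  : ∀ {n} → Term n → Term n → Formula n
  _≺_  : ∀ {n} → Term n → Term n → Formula n
  neg  : ∀ {n} → Formula n → Formula n
  _∧ᶠ_ : ∀ {n} → Formula n → Formula n → Formula n
  _∨ᶠ_ : ∀ {n} → Formula n → Formula n → Formula n
  _⇒ᶠ_ : ∀ {n} → Formula n → Formula n → Formula n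
  all  : ∀ {n} → Formula (suc n) → Formula n
  ex   : ∀ {n} → Formula (suc n) → Formula n

evalT : ∀ {n} → Vector ℤ n → Term n → ℤ
evalT ρ (var i) = ρ i
evalT ρ zer = + 0
evalT ρ (plus s t) = evalT ρ s ℤ.+ evalT ρ t
evalT ρ (fₜ t) = f (evalT ρ t)

⟦_⟧ : ∀ {n} → Formula n → Vector ℤ n → Set
⟦ s ≐ t ⟧ ρ = evalT ρ s ≡ evalT ρ t
⟦ s ≺ t ⟧ ρ = evalT ρ s ℤ.< evalT ρ t
⟦ neg φ ⟧ ρ = ¬ (⟦ φ ⟧ ρ)
⟦ φ ∧ᶠ ψ ⟧ ρ = ⟦ φ ⟧ ρ × ⟦ ψ ⟧ ρ
⟦ φ ∨ᶠ ψ ⟧ ρ = ⟦ φ ⟧ ρ ⊎ ⟦ ψ ⟧ ρ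
⟦ φ ⇒ᶠ ψ ⟧ ρ = ⟦ φ ⟧ ρ → ⟦ ψ ⟧ ρ
⟦ all φ ⟧ ρ = (z : ℤ) → ⟦ φ ⟧ (z ∷ ρ)
⟦ ex φ ⟧ ρ = Σ ℤ λ z → ⟦ φ ⟧ (z ∷ ρ)

data QF : ∀ {n} → Formula n → Set where
  qf-eq  : ∀ {n} (s t : Term n) → QF (s ≐ t)
  qf-lt  : ∀ {n} (s t : Term n) → QF (s ≺ t)
  qf-neg : ∀ {n} {φ : Formula n} → QF φ → QF (neg φ)
  qf-and : ∀ {n} {φ ψ : Formula n} → QF φ → QF ψ → QF (φ ∧ᶠ ψ)
  qf-or  : ∀ {n} {φ ψ : Formula n} → QF φ → QF ψ → QF (φ ∨ᶠ ψ)
  qf-imp : ∀ {n} {φ ψ : Formula n} → QF φ → QF ψ → QF (φ ⇒ᶠ ψ)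

data Π₁ : ∀ {n} → Formula n → Set where
  π-qf  : ∀ {n} {φ : Formula n} → QF φ → Π₁ φ
  π-all : ∀ {n} {φ : Formula (suc n)} → Π₁ φ → Π₁ (all φ)

Π₁-Definable : (ℤ → Set) → Set
Π₁-Definable S =
  Σ (Formula 1) λ φ → Π₁ φ × ((z : ℤ) → (⟦ φ ⟧ (z ∷ (λ ())) → S z) × (S z → ⟦ φ ⟧ (z ∷ (λ ()))))

{-# OPTIONS --safe #-}
module Submission where

-- Write {t} for the fractional part of t.  Since f (w + u) - f w - f u = ⌊ {wφ} + {uφ} ⌋,
-- the equation f (w + u) = f w + f u holds iff {uφ} ≤ {(w + u)φ}.  With x′ = -x and y′ = -y
-- the formula therefore says: x > 0, and for every 0 < y < x, {yφ} lies between {xφ} and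
-- {-xφ} = 1 - {xφ}, i.e. y φ is at least as far from ℤ as x φ.  The numbers with this property
-- are the best-approximation denominators of φ, the Fibonacci numbers:
-- ‖F k φ‖ = |F k φ - F (k+1)| = E k, and because (F j , F (j+1)) and (F (j+1) , F (j+2)) form a
-- basis of ℤ² (Cassini), every lattice point (q , p) with 0 < q < F (j+2) other than
-- (F (j+1) , F (j+2)) has |q φ - p| > E (j+1).
-- All of this is computed exactly in ℤ[φ]: the sign of a + b φ is decided by comparing 2a + b
-- with ⌊ -b √5 ⌋, an integer square root, and positivity is closed under addition because
-- ⌊ x √5 ⌋ is subadditive up to 1.

open import Defs
open import Data.Bool using (true; false; T)
import Data.Fin as Fin
open import Data.Integer as ℤ
  using (ℤ; +_; -[1+_]; +[1+_]; +0; 0ℤ; 1ℤ; -1ℤ; _+_; _-_; -_; _*_; _≤_; _<_; +≤+; +<+; -≤-; -≤+; -<+)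
import Data.Integer.Properties as ℤₚ
open import Data.Integer.Tactic.RingSolver using (solve-∀; solve)
open import Data.List using ([]; _∷_)
open import Data.Nat as ℕ using (ℕ; zero; suc; z≤n; s≤s; _≤ᵇ_)
open import Data.Nat.DivMod using (_/_; _%_; m≡m%n+[m/n]*n; m%n<n)
import Data.Nat.Properties as ℕₚ
import Data.Nat.Tactic.RingSolver as ℕ-Solver
open import Data.Product using (Σ; ∃₂; _×_; _,_; proj₁; proj₂)
open import Data.Product.Function.NonDependent.Propositional using (_×-⇔_)
open import Data.Sum using (_⊎_; inj₁; inj₂)
import Data.Sum as Sum
open import Data.Sum.Function.Propositional using (_⊎-⇔_)
open import Data.Unit using (tt)
open import Function.Bundles using (_⇔_; mk⇔; module Equivalence)
open import Level using (0ℓ)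
open import Relation.Binary
  using (Rel; Irreflexive; Transitive; Trichotomous; tri<; tri≈; tri>; StrictPartialOrder)
import Relation.Binary.Reasoning.StrictPartialOrder
open import Relation.Binary.PropositionalEquality
open import Relation.Nullary using (¬_; yes; no; contradiction)

import Algebra.Properties.AbelianGroup ℤₚ.+-0-abelianGroup as ℤ-group

-- Integer square roots and ⌊ n √5 ⌋

isqrt-spec : ∀ n → isqrt n ℕ.* isqrt n ℕ.≤ n × n ℕ.< suc (isqrt n) ℕ.* suc (isqrt n)
isqrt-spec zero = z≤n , s≤s z≤n
isqrt-spec (suc n) with isqrt-spec n
... | r²≤n , n<[1+r]² with suc (isqrt n) ℕ.* suc (isqrt n) ≤ᵇ suc n in eq
... | true  = ℕₚ.≤ᵇ⇒≤ _ _ (subst T (sym eq) tt)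
            , ℕₚ.≤-<-trans n<[1+r]² (ℕₚ.*-mono-< (ℕₚ.n<1+n (suc (isqrt n))) (ℕₚ.n<1+n (suc (isqrt n))))
... | false = ℕₚ.m≤n⇒m≤1+n r²≤n , ℕₚ.≰⇒> (λ le → subst T eq (ℕₚ.≤⇒≤ᵇ le))

sq≤⇒≤isqrt : ∀ {r n} → r ℕ.* r ℕ.≤ n → r ℕ.≤ isqrt n
sq≤⇒≤isqrt {r} {n} r²≤n = ℕₚ.≮⇒≥ λ isqrt<r →
  ℕₚ.<-irrefl refl
    (ℕₚ.<-≤-trans (proj₂ (isqrt-spec n)) (ℕₚ.≤-trans (ℕₚ.*-mono-≤ isqrt<r isqrt<r) r²≤n))

<sq⇒isqrt< : ∀ {r n} → n ℕ.< r ℕ.* r → isqrt n ℕ.< r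
<sq⇒isqrt< {r} {n} n<r² = ℕₚ.≰⇒> λ r≤isqrt →
  ℕₚ.<-irrefl refl
    (ℕₚ.<-≤-trans n<r² (ℕₚ.≤-trans (ℕₚ.*-mono-≤ r≤isqrt r≤isqrt) (proj₁ (isqrt-spec n))))

m*m≤n*n⇒m≤n : ∀ {m n} → m ℕ.* m ℕ.≤ n ℕ.* n → m ℕ.≤ n
m*m≤n*n⇒m≤n m²≤n² = ℕₚ.≮⇒≥ λ n<m → ℕₚ.<⇒≱ (ℕₚ.*-mono-< n<m n<m) m²≤n²

m*m<n*n⇒m<n : ∀ {m n} → m ℕ.* m ℕ.< n ℕ.* n → m ℕ.< n
m*m<n*n⇒m<n m²<n² = ℕₚ.≰⇒> λ n≤m → ℕₚ.<⇒≱ m²<n² (ℕₚ.*-mono-≤ n≤m n≤m)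

infix 4 _≤√_·_ √_·_<_

_≤√_·_ : ℕ → ℕ → ℕ → Set
x ≤√ c · u = x ℕ.* x ℕ.≤ c ℕ.* (u ℕ.* u)

√_·_<_ : ℕ → ℕ → ℕ → Set
√ c · u < x = c ℕ.* (u ℕ.* u) ℕ.< x ℕ.* x

-- Expand the squares; the cross terms compare because (x y)² ≤ (c u v)².
≤√·-+ : ∀ c {x y u v} → x ≤√ c · u → y ≤√ c · v → x ℕ.+ y ≤√ c · (u ℕ.+ v)
≤√·-+ c {x} {y} {u} {v} x≤√cu y≤√cv = begin
  (x ℕ.+ y) ℕ.* (x ℕ.+ y)
    ≡⟨ ℕ-Solver.solve (x ∷ y ∷ []) ⟩
  x ℕ.* x ℕ.+ 2 ℕ.* (x ℕ.* y) ℕ.+ y ℕ.* y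
    ≤⟨ ℕₚ.+-mono-≤ (ℕₚ.+-mono-≤ x≤√cu (ℕₚ.*-monoʳ-≤ 2 xy≤cuv)) y≤√cv ⟩
  c ℕ.* (u ℕ.* u) ℕ.+ 2 ℕ.* (c ℕ.* u ℕ.* v) ℕ.+ c ℕ.* (v ℕ.* v)
    ≡⟨ ℕ-Solver.solve (c ∷ u ∷ v ∷ []) ⟩
  c ℕ.* ((u ℕ.+ v) ℕ.* (u ℕ.+ v))
    ∎
  where
  open ℕₚ.≤-Reasoning
  xy≤cuv : x ℕ.* y ℕ.≤ c ℕ.* u ℕ.* v
  xy≤cuv = m*m≤n*n⇒m≤n (begin
    (x ℕ.* y) ℕ.* (x ℕ.* y)                   ≡⟨ ℕ-Solver.solve (x ∷ y ∷ []) ⟩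
    (x ℕ.* x) ℕ.* (y ℕ.* y)                   ≤⟨ ℕₚ.*-mono-≤ x≤√cu y≤√cv ⟩
    (c ℕ.* (u ℕ.* u)) ℕ.* (c ℕ.* (v ℕ.* v))   ≡⟨ ℕ-Solver.solve (c ∷ u ∷ v ∷ []) ⟩
    (c ℕ.* u ℕ.* v) ℕ.* (c ℕ.* u ℕ.* v)       ∎)

√·<-+ : ∀ c {x y u v} → √ c · u < x → √ c · v < y → √ c · (u ℕ.+ v) < x ℕ.+ y
√·<-+ c {x} {y} {u} {v} √cu<x √cv<y = begin-strict
  c ℕ.* ((u ℕ.+ v) ℕ.* (u ℕ.+ v))
    ≡⟨ ℕ-Solver.solve (c ∷ u ∷ v ∷ []) ⟩
  c ℕ.* (u ℕ.* u) ℕ.+ 2 ℕ.* (c ℕ.* u ℕ.* v) ℕ.+ c ℕ.* (v ℕ.* v)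
    <⟨ ℕₚ.+-mono-< (ℕₚ.+-mono-<-≤ √cu<x (ℕₚ.*-monoʳ-≤ 2 (ℕₚ.<⇒≤ cuv<xy))) √cv<y ⟩
  x ℕ.* x ℕ.+ 2 ℕ.* (x ℕ.* y) ℕ.+ y ℕ.* y
    ≡⟨ ℕ-Solver.solve (x ∷ y ∷ []) ⟩
  (x ℕ.+ y) ℕ.* (x ℕ.+ y)
    ∎
  where
  open ℕₚ.≤-Reasoning
  cuv<xy : c ℕ.* u ℕ.* v ℕ.< x ℕ.* y
  cuv<xy = m*m<n*n⇒m<n (begin-strict
    (c ℕ.* u ℕ.* v) ℕ.* (c ℕ.* u ℕ.* v)       ≡⟨ ℕ-Solver.solve (c ∷ u ∷ v ∷ []) ⟩
    (c ℕ.* (u ℕ.* u)) ℕ.* (c ℕ.* (v ℕ.* v))   <⟨ ℕₚ.*-mono-< √cu<x √cv<y ⟩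
    (x ℕ.* x) ℕ.* (y ℕ.* y)                   ≡⟨ ℕ-Solver.solve (x ∷ y ∷ []) ⟩
    (x ℕ.* y) ℕ.* (x ℕ.* y)                   ∎)

⌊_√5⌋ : ℕ → ℕ
⌊ n √5⌋ = isqrt (5 ℕ.* (n ℕ.* n))

⌊√5⌋-superadditive : ∀ m n → ⌊ m √5⌋ ℕ.+ ⌊ n √5⌋ ℕ.≤ ⌊ m ℕ.+ n √5⌋
⌊√5⌋-superadditive m n =
  sq≤⇒≤isqrt (≤√·-+ 5 {⌊ m √5⌋} {⌊ n √5⌋} {m} {n} (proj₁ (isqrt-spec _)) (proj₁ (isqrt-spec _)))

⌊√5⌋-subadditive : ∀ m n → ⌊ m ℕ.+ n √5⌋ ℕ.≤ ⌊ m √5⌋ ℕ.+ ⌊ n √5⌋ ℕ.+ 1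
⌊√5⌋-subadditive m n = ℕ.s≤s⁻¹ (subst (⌊ m ℕ.+ n √5⌋ ℕ.<_) [1+a]+[1+b]≡1+[a+b+1]
  (<sq⇒isqrt< (√·<-+ 5 {suc a} {suc b} {m} {n} (proj₂ (isqrt-spec _)) (proj₂ (isqrt-spec _)))))
  where
  a b : ℕ
  a = ⌊ m √5⌋
  b = ⌊ n √5⌋
  [1+a]+[1+b]≡1+[a+b+1] : suc a ℕ.+ suc b ≡ suc (a ℕ.+ b ℕ.+ 1)
  [1+a]+[1+b]≡1+[a+b+1] = cong suc (trans (ℕₚ.+-suc a b) (ℕₚ.+-comm 1 (a ℕ.+ b)))

-- For n ≠ 0, n √5 is irrational, so ⌊ -n √5 ⌋ = -⌊ n √5 ⌋ - 1.
⌊_√5⌋ᶻ : ℤ → ℤ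
⌊ + n √5⌋ᶻ      = + ⌊ n √5⌋
⌊ -[1+ n ] √5⌋ᶻ = -[1+ ⌊ suc n √5⌋ ]

private
  ⌊√5⌋ᶻ-subadditive-+- : ∀ m n → ⌊ + m + -[1+ n ] √5⌋ᶻ ≤ ⌊ + m √5⌋ᶻ + ⌊ -[1+ n ] √5⌋ᶻ + 1ℤ
  ⌊√5⌋ᶻ-subadditive-+- m n with m ℕₚ.≤? n
  ... | yes m≤n with ℕₚ.m≤n⇒∃[o]m+o≡n m≤n
  ...   | t , refl = begin
    ⌊ + m + -[1+ m ℕ.+ t ] √5⌋ᶻ
      ≡⟨ cong ⌊_√5⌋ᶻ (a+-[1+a+b]≡-[1+b] (+ m) (+ t)) ⟩
    - (1ℤ + + ⌊ suc t √5⌋)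
      ≤⟨ rearrange {+ ⌊ m √5⌋} {+ ⌊ suc t √5⌋} (+≤+ N≤M+B+1) ⟩
    + ⌊ m √5⌋ + - (1ℤ + + ⌊ suc (m ℕ.+ t) √5⌋) + 1ℤ
      ∎
    where
    open ℤₚ.≤-Reasoning
    a+-[1+a+b]≡-[1+b] : ∀ a b → a + - (1ℤ + (a + b)) ≡ - (1ℤ + b)
    a+-[1+a+b]≡-[1+b] = solve-∀
    rearrange : ∀ {a b c} → c ≤ a + b + 1ℤ → - (1ℤ + b) ≤ a + - (1ℤ + c) + 1ℤ
    rearrange {a} {b} {c} c≤a+b+1 = begin
      - (1ℤ + b)                      ≡⟨ solve (a ∷ b ∷ []) ⟩
      a + - (1ℤ + (a + b + 1ℤ)) + 1ℤ
        ≤⟨ ℤₚ.+-monoˡ-≤ 1ℤ (ℤₚ.+-monoʳ-≤ a (ℤₚ.neg-mono-≤ (ℤₚ.+-monoʳ-≤ 1ℤ c≤a+b+1))) ⟩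
      a + - (1ℤ + c) + 1ℤ             ∎
    N≤M+B+1 : ⌊ suc (m ℕ.+ t) √5⌋ ℕ.≤ ⌊ m √5⌋ ℕ.+ ⌊ suc t √5⌋ ℕ.+ 1
    N≤M+B+1 = subst (λ k → ⌊ k √5⌋ ℕ.≤ ⌊ m √5⌋ ℕ.+ ⌊ suc t √5⌋ ℕ.+ 1) (ℕₚ.+-suc m t)
                    (⌊√5⌋-subadditive m (suc t))
  ⌊√5⌋ᶻ-subadditive-+- m n | no m≰n with ℕₚ.m≤n⇒∃[o]m+o≡n (ℕₚ.≰⇒> m≰n)
  ...   | r , refl = begin
    ⌊ + (suc n ℕ.+ r) + -[1+ n ] √5⌋ᶻ
      ≡⟨ cong ⌊_√5⌋ᶻ (1+a+b+-[1+a]≡b (+ n) (+ r)) ⟩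
    + ⌊ r √5⌋
      ≤⟨ rearrange {b = + ⌊ suc n √5⌋} (+≤+ (⌊√5⌋-superadditive (suc n) r)) ⟩
    + ⌊ suc n ℕ.+ r √5⌋ + - (1ℤ + + ⌊ suc n √5⌋) + 1ℤ
      ∎
    where
    open ℤₚ.≤-Reasoning
    1+a+b+-[1+a]≡b : ∀ a b → 1ℤ + a + b + - (1ℤ + a) ≡ b
    1+a+b+-[1+a]≡b = solve-∀
    rearrange : ∀ {a b c} → b + c ≤ a → c ≤ a + - (1ℤ + b) + 1ℤ
    rearrange {a} {b} {c} b+c≤a = begin
      c                           ≡⟨ solve (b ∷ c ∷ []) ⟩
      (b + c) + (- (1ℤ + b) + 1ℤ) ≤⟨ ℤₚ.+-monoˡ-≤ (- (1ℤ + b) + 1ℤ) b+c≤a ⟩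
      a + (- (1ℤ + b) + 1ℤ)       ≡⟨ solve (a ∷ b ∷ []) ⟩
      a + - (1ℤ + b) + 1ℤ         ∎

⌊√5⌋ᶻ-subadditive : ∀ x y → ⌊ x + y √5⌋ᶻ ≤ ⌊ x √5⌋ᶻ + ⌊ y √5⌋ᶻ + 1ℤ
⌊√5⌋ᶻ-subadditive (+ m)    (+ n)    = +≤+ (⌊√5⌋-subadditive m n)
⌊√5⌋ᶻ-subadditive (+ m)    -[1+ n ] = ⌊√5⌋ᶻ-subadditive-+- m n
⌊√5⌋ᶻ-subadditive -[1+ m ] (+ n)    = begin
  ⌊ -[1+ m ] + + n √5⌋ᶻ
    ≡⟨ cong ⌊_√5⌋ᶻ (ℤₚ.+-comm -[1+ m ] (+ n)) ⟩
  ⌊ + n + -[1+ m ] √5⌋ᶻ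
    ≤⟨ ⌊√5⌋ᶻ-subadditive-+- n m ⟩
  ⌊ + n √5⌋ᶻ + ⌊ -[1+ m ] √5⌋ᶻ + 1ℤ
    ≡⟨ cong (_+ 1ℤ) (ℤₚ.+-comm ⌊ + n √5⌋ᶻ ⌊ -[1+ m ] √5⌋ᶻ) ⟩
  ⌊ -[1+ m ] √5⌋ᶻ + ⌊ + n √5⌋ᶻ + 1ℤ
    ∎
  where open ℤₚ.≤-Reasoning
⌊√5⌋ᶻ-subadditive -[1+ m ] -[1+ n ] =
  -≤- (subst (λ k → ⌊ suc m √5⌋ ℕ.+ ⌊ suc n √5⌋ ℕ.≤ ⌊ suc k √5⌋) (ℕₚ.+-suc m n)
        (⌊√5⌋-superadditive (suc m) (suc n)))

-- The ordered group ℤ[φ]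

infix  5 _+φ_
infixl 6 _⊕_ _⊖_
infixr 7 _⊛_
infix  8 ⊖_ _·φ

-- a +φ b stands for the real number a + b φ.
record ℤ[φ] : Set where
  constructor _+φ_
  field
    re im : ℤ

_⊕_ : ℤ[φ] → ℤ[φ] → ℤ[φ]
(a +φ b) ⊕ (c +φ d) = a + c +φ b + d

⊖_ : ℤ[φ] → ℤ[φ]
⊖ (a +φ b) = - a +φ - b

_⊖_ : ℤ[φ] → ℤ[φ] → ℤ[φ]
ξ ⊖ η = ξ ⊕ ⊖ η

_⊛_ : ℤ → ℤ[φ] → ℤ[φ]
k ⊛ (a +φ b) = k * a +φ k * b

ι : ℤ → ℤ[φ]
ι a = a +φ 0ℤ

_·φ : ℤ → ℤ[φ]
b ·φ = 0ℤ +φ b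

⊕-inverseʳ : ∀ ξ → ξ ⊖ ξ ≡ ι 0ℤ
⊕-inverseʳ (a +φ b) = cong₂ _+φ_ (ℤₚ.+-inverseʳ a) (ℤₚ.+-inverseʳ b)

⊖-involutive : ∀ ξ → ⊖ ⊖ ξ ≡ ξ
⊖-involutive (a +φ b) = cong₂ _+φ_ (ℤₚ.neg-involutive a) (ℤₚ.neg-involutive b)

⊖[ξ⊖η]≡η⊖ξ : ∀ ξ η → ⊖ (ξ ⊖ η) ≡ η ⊖ ξ
⊖[ξ⊖η]≡η⊖ξ (a +φ b) (c +φ d) = cong₂ _+φ_ (lemma a c) (lemma b d)
  where
  lemma : ∀ a c → - (a + - c) ≡ c + - a
  lemma = solve-∀

ξ⊖η≡0⇒ξ≡η : ∀ {ξ η} → ξ ⊖ η ≡ ι 0ℤ → ξ ≡ η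
ξ⊖η≡0⇒ξ≡η {a +φ b} {c +φ d} eq =
  cong₂ _+φ_ (ℤₚ.i-j≡0⇒i≡j a c (cong ℤ[φ].re eq)) (ℤₚ.i-j≡0⇒i≡j b d (cong ℤ[φ].im eq))

⊖-telescope : ∀ ξ η ζ → (ξ ⊖ η) ⊕ (η ⊖ ζ) ≡ ξ ⊖ ζ
⊖-telescope (a +φ b) (c +φ d) (e +φ g) = cong₂ _+φ_ (lemma a c e) (lemma b d g)
  where
  lemma : ∀ a c e → a + - c + (c + - e) ≡ a + - e
  lemma = solve-∀

⊖-identityʳ : ∀ ξ → ξ ⊖ ι 0ℤ ≡ ξ
⊖-identityʳ (a +φ b) = cong₂ _+φ_ (ℤₚ.+-identityʳ a) (ℤₚ.+-identityʳ b)

η⊖[η⊖ξ]≡ξ : ∀ η ξ → η ⊖ (η ⊖ ξ) ≡ ξ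
η⊖[η⊖ξ]≡ξ (a +φ b) (c +φ d) = cong₂ _+φ_ (lemma a c) (lemma b d)
  where
  lemma : ∀ a c → a + - (a + - c) ≡ c
  lemma = solve-∀

ι0⊖[ξ⊖η]≡η⊖ξ : ∀ ξ η → ι 0ℤ ⊖ (ξ ⊖ η) ≡ η ⊖ ξ
ι0⊖[ξ⊖η]≡η⊖ξ (a +φ b) (c +φ d) = cong₂ _+φ_ (lemma a c) (lemma b d)
  where
  lemma : ∀ a c → 0ℤ + - (a + - c) ≡ c + - a
  lemma = solve-∀

[η⊕ξ]⊖η≡ξ : ∀ η ξ → (η ⊕ ξ) ⊖ η ≡ ξ
[η⊕ξ]⊖η≡ξ (a +φ b) (c +φ d) = cong₂ _+φ_ (lemma a c) (lemma b d)
  where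
  lemma : ∀ a c → a + c + - a ≡ c
  lemma = solve-∀

⊕-⊖-cancelʳ : ∀ ξ η ζ → (ξ ⊕ η) ⊖ (ζ ⊕ η) ≡ ξ ⊖ ζ
⊕-⊖-cancelʳ (a +φ b) (c +φ d) (e +φ g) = cong₂ _+φ_ (lemma a c e) (lemma b d g)
  where
  lemma : ∀ a c e → a + c + - (e + c) ≡ a + - e
  lemma = solve-∀

⊕-⊖-cancelˡ : ∀ ξ η ζ → (η ⊕ ξ) ⊖ (η ⊕ ζ) ≡ ξ ⊖ ζ
⊕-⊖-cancelˡ (a +φ b) (c +φ d) (e +φ g) = cong₂ _+φ_ (lemma a c e) (lemma b d g)
  where
  lemma : ∀ a c e → c + a + - (c + e) ≡ a + - e
  lemma = solve-∀

ι-⊖-⊖ι : ∀ c a ξ → ι c ⊖ (ξ ⊖ ι a) ≡ ι (c + a) ⊖ ξ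
ι-⊖-⊖ι c a (d +φ e) = cong₂ _+φ_ (re-lemma c a d) (im-lemma e)
  where
  re-lemma : ∀ c a d → c + - (d + - a) ≡ c + a + - d
  re-lemma = solve-∀
  im-lemma : ∀ e → 0ℤ + - (e + - 0ℤ) ≡ 0ℤ + - e
  im-lemma = solve-∀

ι-⊖-·φ : ∀ a b → ι a ⊖ b ·φ ≡ a +φ - b
ι-⊖-·φ a b = cong₂ _+φ_ (ℤₚ.+-identityʳ a) (ℤₚ.+-identityˡ (- b))

⊛-identityˡ : ∀ ξ → 1ℤ ⊛ ξ ≡ ξ
⊛-identityˡ (a +φ b) = cong₂ _+φ_ (ℤₚ.*-identityˡ a) (ℤₚ.*-identityˡ b)

-1⊛ξ≡⊖ξ : ∀ ξ → -1ℤ ⊛ ξ ≡ ⊖ ξ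
-1⊛ξ≡⊖ξ (a +φ b) = cong₂ _+φ_ (ℤₚ.-1*i≡-i a) (ℤₚ.-1*i≡-i b)

-- a + b φ > 0  iff  (2a + b) + b √5 > 0  iff  ⌊ -b √5 ⌋ < 2a + b.
Positive : ℤ[φ] → Set
Positive (a +φ b) = ⌊ - b √5⌋ᶻ < + 2 * a + b

positive-⊕ : ∀ {ξ η} → Positive ξ → Positive η → Positive (ξ ⊕ η)
positive-⊕ {a +φ b} {c +φ d} ⌊-b√5⌋<2a+b ⌊-d√5⌋<2c+d = begin-strict
  ⌊ - (b + d) √5⌋ᶻ                    ≡⟨ cong ⌊_√5⌋ᶻ (ℤₚ.neg-distrib-+ b d) ⟩
  ⌊ - b + - d √5⌋ᶻ                    ≤⟨ ⌊√5⌋ᶻ-subadditive (- b) (- d) ⟩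
  ⌊ - b √5⌋ᶻ + ⌊ - d √5⌋ᶻ + 1ℤ        ≡⟨ ℤₚ.+-assoc ⌊ - b √5⌋ᶻ ⌊ - d √5⌋ᶻ 1ℤ ⟩
  ⌊ - b √5⌋ᶻ + (⌊ - d √5⌋ᶻ + 1ℤ)
    ≡⟨ cong (λ t → ⌊ - b √5⌋ᶻ + t) (ℤₚ.+-comm ⌊ - d √5⌋ᶻ 1ℤ) ⟩
  ⌊ - b √5⌋ᶻ + (1ℤ + ⌊ - d √5⌋ᶻ)
    <⟨ ℤₚ.+-mono-<-≤ ⌊-b√5⌋<2a+b (ℤₚ.i<j⇒suc[i]≤j ⌊-d√5⌋<2c+d) ⟩
  (+ 2 * a + b) + (+ 2 * c + d)       ≡⟨ solve (a ∷ b ∷ c ∷ d ∷ []) ⟩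
  + 2 * (a + c) + (b + d)             ∎
  where open ℤₚ.≤-Reasoning

positive-ι : ∀ {a} → 0ℤ < a → Positive (ι a)
positive-ι {a} 0<a = subst (0ℤ <_) (sym (ℤₚ.+-identityʳ (+ 2 * a))) (ℤₚ.*-monoˡ-<-pos (+ 2) 0<a)

private
  neg-suc-< : ∀ {c s} → - c ≤ s → - (1ℤ + s) < c
  neg-suc-< {c} {s} -c≤s = begin-strict
    - (1ℤ + s)   <⟨ ℤₚ.suc[i]≤j⇒i<j (ℤₚ.≤-reflexive (1+-[1+s]≡-s s)) ⟩
    - s          ≤⟨ ℤₚ.neg-mono-≤ -c≤s ⟩
    - - c        ≡⟨ ℤₚ.neg-involutive c ⟩
    c            ∎
    where
    open ℤₚ.≤-Reasoning
    1+-[1+s]≡-s : ∀ s → 1ℤ + - (1ℤ + s) ≡ - s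
    1+-[1+s]≡-s = solve-∀

-- For b ≠ 0, ⌊ -b √5 ⌋ = -1 - ⌊ b √5 ⌋, so a + b φ or its negative is positive.
positive-trichotomy : ∀ ξ → Positive ξ ⊎ ξ ≡ ι 0ℤ ⊎ Positive (⊖ ξ)
positive-trichotomy (a +φ +0) with ℤₚ.<-cmp 0ℤ a
... | tri< 0<a _ _ = inj₁ (positive-ι 0<a)
... | tri≈ _ refl _ = inj₂ (inj₁ refl)
... | tri> _ _ a<0 = inj₂ (inj₂ (positive-ι (ℤₚ.neg-mono-< a<0)))
positive-trichotomy (a +φ +[1+ n ]) with ⌊ +[1+ n ] √5⌋ᶻ ℤ.<? + 2 * - a + -[1+ n ]
... | yes p = inj₂ (inj₂ p)
... | no ¬p = inj₁ (neg-suc-< (subst (_≤ + ⌊ suc n √5⌋) (neg-2a+b (+[1+ n ])) (ℤₚ.≮⇒≥ ¬p)))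
  where
  neg-2a+b : ∀ b → + 2 * - a + - b ≡ - (+ 2 * a + b)
  neg-2a+b b = solve (a ∷ b ∷ [])
positive-trichotomy (a +φ -[1+ n ]) with ⌊ +[1+ n ] √5⌋ᶻ ℤ.<? + 2 * a + -[1+ n ]
... | yes p = inj₁ p
... | no ¬p = inj₂ (inj₂ (neg-suc-< (subst (_≤ + ⌊ suc n √5⌋) (neg-2a+b (-[1+ n ])) (ℤₚ.≮⇒≥ ¬p))))
  where
  neg-2a+b : ∀ b → + 2 * a + b ≡ - (+ 2 * - a + - b)
  neg-2a+b b = solve (a ∷ b ∷ [])

private
  pos-sq : ∀ n → + (n ℕ.* n) ≡ + n * + n
  pos-sq n = ℤₚ.pos-* n n

  pos-5sq : ∀ n → + (5 ℕ.* (n ℕ.* n)) ≡ + 5 * (+ n * + n)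
  pos-5sq n = trans (ℤₚ.pos-* 5 (n ℕ.* n)) (cong (+ 5 *_) (pos-sq n))

positive-if-sq< : ∀ {a n c} → + 2 * a + + n ≡ - c → 0ℤ ≤ c → c * c < + 5 * (+ n * + n) → Positive (a +φ + n)
positive-if-sq< {n = zero} {+ z} _ _ c²<0 with subst (_< + 0) (sym (pos-sq z)) c²<0
... | +<+ ()
positive-if-sq< {a} {suc m} {+ z} 2a+n≡-c _ c²<5n² =
  subst (-[1+ ⌊ suc m √5⌋ ] <_) (sym 2a+n≡-c)
    (ℤₚ.neg-mono-< (+<+ (s≤s (sq≤⇒≤isqrt (ℕₚ.<⇒≤ z²<5n²)))))
  where
  z²<5n² : z ℕ.* z ℕ.< 5 ℕ.* (suc m ℕ.* suc m)
  z²<5n² = ℤₚ.drop‿+<+ (subst₂ _<_ (sym (pos-sq z)) (sym (pos-5sq (suc m))) c²<5n²)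

positive-if-5sq< : ∀ {a n c} → + 2 * a + - + n ≡ c → 0ℤ ≤ c → + 5 * (+ n * + n) < c * c → Positive (a +φ - + n)
positive-if-5sq< {a} {n} {+ z} 2a-n≡c _ 5n²<c² =
  subst₂ _<_ (cong ⌊_√5⌋ᶻ (sym (ℤₚ.neg-involutive (+ n)))) (sym 2a-n≡c) (+<+ (<sq⇒isqrt< 5n²<z²))
  where
  5n²<z² : 5 ℕ.* (n ℕ.* n) ℕ.< z ℕ.* z
  5n²<z² = ℤₚ.drop‿+<+ (subst₂ _<_ (sym (pos-5sq n)) (sym (pos-sq z)) 5n²<c²)

infix 4 _<ᵩ_ _≤ᵩ_

record _<ᵩ_ (ξ η : ℤ[φ]) : Set where
  constructor mk<ᵩ
  field
    positive : Positive (η ⊖ ξ)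

_≤ᵩ_ : Rel ℤ[φ] 0ℓ
ξ ≤ᵩ η = ξ <ᵩ η ⊎ ξ ≡ η

<ᵩ-irrefl : Irreflexive _≡_ _<ᵩ_
<ᵩ-irrefl {ξ} refl (mk<ᵩ ξ⊖ξ>0) = ℤₚ.<-irrefl refl (subst Positive (⊕-inverseʳ ξ) ξ⊖ξ>0)

<ᵩ-trans : Transitive _<ᵩ_
<ᵩ-trans {ξ} {η} {ζ} (mk<ᵩ η⊖ξ>0) (mk<ᵩ ζ⊖η>0) =
  mk<ᵩ (subst Positive (⊖-telescope ζ η ξ) (positive-⊕ {ζ ⊖ η} {η ⊖ ξ} ζ⊖η>0 η⊖ξ>0))

<ᵩ-cmp : Trichotomous _≡_ _<ᵩ_
<ᵩ-cmp ξ η with positive-trichotomy (η ⊖ ξ)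
... | inj₁ η⊖ξ>0 =
  tri< ξ<η (λ ξ≡η → <ᵩ-irrefl ξ≡η ξ<η) (λ η<ξ → <ᵩ-irrefl refl (<ᵩ-trans ξ<η η<ξ))
  where
  ξ<η : ξ <ᵩ η
  ξ<η = mk<ᵩ η⊖ξ>0
... | inj₂ (inj₁ η⊖ξ≡0) = tri≈ (<ᵩ-irrefl ξ≡η) ξ≡η (<ᵩ-irrefl (sym ξ≡η))
  where
  ξ≡η : ξ ≡ η
  ξ≡η = sym (ξ⊖η≡0⇒ξ≡η η⊖ξ≡0)
<ᵩ-cmp ξ η | inj₂ (inj₂ p) =
  tri> (λ ξ<η → <ᵩ-irrefl refl (<ᵩ-trans ξ<η η<ξ)) (λ ξ≡η → <ᵩ-irrefl (sym ξ≡η) η<ξ) η<ξ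
  where
  η<ξ : η <ᵩ ξ
  η<ξ = mk<ᵩ (subst Positive (⊖[ξ⊖η]≡η⊖ξ η ξ) p)

<ᵩ-strictPartialOrder : StrictPartialOrder 0ℓ 0ℓ 0ℓ
<ᵩ-strictPartialOrder = record
  { isStrictPartialOrder = record
    { isEquivalence = isEquivalence
    ; irrefl        = <ᵩ-irrefl
    ; trans         = <ᵩ-trans
    ; <-resp-≈      = resp₂ _<ᵩ_
    }
  }

module ≤ᵩ-Reasoning = Relation.Binary.Reasoning.StrictPartialOrder <ᵩ-strictPartialOrder

≮ᵩ⇒≥ᵩ : ∀ {ξ η} → ¬ (ξ <ᵩ η) → η ≤ᵩ ξ
≮ᵩ⇒≥ᵩ {ξ} {η} ξ≮η with <ᵩ-cmp ξ η
... | tri< ξ<η _ _ = contradiction ξ<η ξ≮η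
... | tri≈ _ ξ≡η _ = inj₂ (sym ξ≡η)
... | tri> _ _ η<ξ = inj₁ η<ξ

<ᵩ⇒≱ᵩ : ∀ {ξ η} → ξ <ᵩ η → ¬ (η ≤ᵩ ξ)
<ᵩ⇒≱ᵩ {ξ} {η} ξ<η η≤ξ = <ᵩ-irrefl refl (begin-strict ξ <⟨ ξ<η ⟩ η ≤⟨ η≤ξ ⟩ ξ ∎)
  where open ≤ᵩ-Reasoning

<ᵩ-⊖-cong : ∀ {ξ η ξ′ η′} → η ⊖ ξ ≡ η′ ⊖ ξ′ → ξ <ᵩ η → ξ′ <ᵩ η′
<ᵩ-⊖-cong eq (mk<ᵩ η⊖ξ>0) = mk<ᵩ (subst Positive eq η⊖ξ>0)

≤ᵩ-⊖-cong : ∀ {ξ η ξ′ η′} → η ⊖ ξ ≡ η′ ⊖ ξ′ → ξ ≤ᵩ η → ξ′ ≤ᵩ η′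
≤ᵩ-⊖-cong eq (inj₁ ξ<η) = inj₁ (<ᵩ-⊖-cong eq ξ<η)
≤ᵩ-⊖-cong {ξ} eq (inj₂ refl) = inj₂ (sym (ξ⊖η≡0⇒ξ≡η (trans (sym eq) (⊕-inverseʳ ξ))))

⊕-monoˡ-≤ᵩ : ∀ {ξ ξ′} η → ξ ≤ᵩ ξ′ → ξ ⊕ η ≤ᵩ ξ′ ⊕ η
⊕-monoˡ-≤ᵩ {ξ} {ξ′} η = ≤ᵩ-⊖-cong (sym (⊕-⊖-cancelʳ ξ′ η ξ))

⊕-monoʳ-≤ᵩ : ∀ ξ {η η′} → η ≤ᵩ η′ → ξ ⊕ η ≤ᵩ ξ ⊕ η′
⊕-monoʳ-≤ᵩ ξ {η} {η′} = ≤ᵩ-⊖-cong (sym (⊕-⊖-cancelˡ η′ ξ η))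

⊕-mono-≤ᵩ : ∀ {ξ ξ′ η η′} → ξ ≤ᵩ ξ′ → η ≤ᵩ η′ → ξ ⊕ η ≤ᵩ ξ′ ⊕ η′
⊕-mono-≤ᵩ {ξ} {ξ′} {η} {η′} ξ≤ξ′ η≤η′ = begin
  ξ ⊕ η    ≤⟨ ⊕-monoˡ-≤ᵩ η ξ≤ξ′ ⟩
  ξ′ ⊕ η   ≤⟨ ⊕-monoʳ-≤ᵩ ξ′ η≤η′ ⟩
  ξ′ ⊕ η′  ∎
  where open ≤ᵩ-Reasoning

ι-mono-< : ∀ {m n} → m < n → ι m <ᵩ ι n
ι-mono-< {m} {n} m<n = mk<ᵩ (positive-ι (subst (_< n - m) (ℤₚ.+-inverseʳ m) (ℤₚ.+-monoˡ-< (- m) m<n)))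

ι-mono-≤ : ∀ {m n} → m ≤ n → ι m ≤ᵩ ι n
ι-mono-≤ {m} {n} m≤n with m ℤ.≟ n
... | yes refl = inj₂ refl
... | no m≢n   = inj₁ (ι-mono-< (ℤₚ.≤∧≢⇒< m≤n m≢n))

positive⇒0<ᵩ : ∀ {ξ} → Positive ξ → ι 0ℤ <ᵩ ξ
positive⇒0<ᵩ {ξ} ξ>0 = mk<ᵩ (subst Positive (sym (⊖-identityʳ ξ)) ξ>0)

0<ᵩ⇒positive : ∀ {ξ} → ι 0ℤ <ᵩ ξ → Positive ξ
0<ᵩ⇒positive {ξ} (mk<ᵩ ξ⊖0>0) = subst Positive (⊖-identityʳ ξ) ξ⊖0>0

0≤ᵩ+n⊛ : ∀ {ξ} n → ι 0ℤ <ᵩ ξ → ι 0ℤ ≤ᵩ + n ⊛ ξ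
0≤ᵩ+n⊛ {a +φ b} zero    _   = inj₂ (cong₂ _+φ_ (sym (ℤₚ.*-zeroˡ a)) (sym (ℤₚ.*-zeroˡ b)))
0≤ᵩ+n⊛ {ξ}      (suc n) 0<ξ = inj₁ (positive⇒0<ᵩ (positive-+[1+n]⊛ n))
  where
  positive-+[1+n]⊛ : ∀ n → Positive (+[1+ n ] ⊛ ξ)
  positive-+[1+n]⊛ zero    = subst Positive (sym (⊛-identityˡ ξ)) (0<ᵩ⇒positive 0<ξ)
  positive-+[1+n]⊛ (suc n) = subst Positive (⊛-suc ξ) (positive-⊕ {ξ} (0<ᵩ⇒positive 0<ξ) (positive-+[1+n]⊛ n))
    where
    ⊛-suc : ∀ ξ → ξ ⊕ +[1+ n ] ⊛ ξ ≡ +[1+ suc n ] ⊛ ξ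
    ⊛-suc (a +φ b) = cong₂ _+φ_ (lemma (+ n) a) (lemma (+ n) b)
      where
      lemma : ∀ n a → a + (1ℤ + n) * a ≡ (1ℤ + (1ℤ + n)) * a
      lemma = solve-∀

infix 4 _<∣_∣

_<∣_∣ : ℤ[φ] → ℤ[φ] → Set
K <∣ ξ ∣ = K <ᵩ ξ ⊎ K <ᵩ ⊖ ξ

<∣⊖∣ : ∀ {K ξ} → K <∣ ξ ∣ → K <∣ ⊖ ξ ∣
<∣⊖∣ {K} {ξ} (inj₁ K<ξ) = inj₂ (subst (K <ᵩ_) (sym (⊖-involutive ξ)) K<ξ)
<∣⊖∣ (inj₂ K<⊖ξ) = inj₁ K<⊖ξ

-- The floor function f and fractional parts

private
  halve-spec : ∀ n → + 2 * + (n / 2) ≤ + n × + n ≤ + 2 * + (n / 2) + 1ℤ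
  halve-spec n = subst (_≤ + n) (ℤₚ.pos-* 2 q) (+≤+ lower)
               , subst (λ t → + n ≤ t + 1ℤ) (ℤₚ.pos-* 2 q) (+≤+ upper)
    where
    open ℕₚ.≤-Reasoning
    q r : ℕ
    q = n / 2
    r = n % 2
    lower : 2 ℕ.* q ℕ.≤ n
    lower = begin
      2 ℕ.* q       ≡⟨ ℕₚ.*-comm 2 q ⟩
      q ℕ.* 2       ≤⟨ ℕₚ.m≤n+m (q ℕ.* 2) r ⟩
      r ℕ.+ q ℕ.* 2 ≡⟨ m≡m%n+[m/n]*n n 2 ⟨
      n             ∎
    upper : n ℕ.≤ 2 ℕ.* q ℕ.+ 1
    upper = begin
      n             ≡⟨ m≡m%n+[m/n]*n n 2 ⟩
      r ℕ.+ q ℕ.* 2 ≤⟨ ℕₚ.+-monoˡ-≤ (q ℕ.* 2) (ℕ.s≤s⁻¹ (m%n<n n 2)) ⟩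
      1 ℕ.+ q ℕ.* 2 ≡⟨ ℕₚ.+-comm 1 (q ℕ.* 2) ⟩
      q ℕ.* 2 ℕ.+ 1 ≡⟨ cong (ℕ._+ 1) (ℕₚ.*-comm q 2) ⟩
      2 ℕ.* q ℕ.+ 1 ∎

  halve-neg : ∀ {m n} → + 2 * m ≤ n × n ≤ + 2 * m + 1ℤ → + 2 * - m ≤ - n + 1ℤ × - n + 1ℤ ≤ + 2 * - m + 1ℤ
  halve-neg {m} {n} (2m≤n , n≤2m+1) = lower , upper
    where
    open ℤₚ.≤-Reasoning
    lower : + 2 * - m ≤ - n + 1ℤ
    lower = begin
      + 2 * - m              ≡⟨ solve (m ∷ []) ⟩
      - (+ 2 * m + 1ℤ) + 1ℤ  ≤⟨ ℤₚ.+-monoˡ-≤ 1ℤ (ℤₚ.neg-mono-≤ n≤2m+1) ⟩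
      - n + 1ℤ               ∎
    upper : - n + 1ℤ ≤ + 2 * - m + 1ℤ
    upper = begin
      - n + 1ℤ               ≤⟨ ℤₚ.+-monoˡ-≤ 1ℤ (ℤₚ.neg-mono-≤ 2m≤n) ⟩
      - (+ 2 * m) + 1ℤ       ≡⟨ solve (m ∷ []) ⟩
      + 2 * - m + 1ℤ         ∎

f-spec : ∀ x → + 2 * f x ≤ x + ⌊ x √5⌋ᶻ × x + ⌊ x √5⌋ᶻ ≤ + 2 * f x + 1ℤ
f-spec (+ a)    = halve-spec (a ℕ.+ ⌊ a √5⌋)
f-spec -[1+ k ] = subst (λ t → + 2 * f -[1+ k ] ≤ t × t ≤ + 2 * f -[1+ k ] + 1ℤ)
                        (sym (sum≡ (+ k) (+ ⌊ suc k √5⌋)))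
                        (halve-neg (halve-spec (suc k ℕ.+ ⌊ suc k √5⌋ ℕ.+ 2)))
  where
  -- f halves N = (k + 1) + ⌊ (k + 1) √5 ⌋ + 2, and x + ⌊ x √5 ⌋ = 1 - N.
  sum≡ : ∀ k s → - (1ℤ + k) + - (1ℤ + s) ≡ - (1ℤ + k + s + + 2) + 1ℤ
  sum≡ = solve-∀

ι-f≤·φ : ∀ x → ι (f x) ≤ᵩ x ·φ
ι-f≤·φ x = ≮ᵩ⇒≥ᵩ λ { (mk<ᵩ p) →
  ℤₚ.<⇒≱ (rearrange {+ 2 * f x} (subst Positive (ι-⊖-·φ (f x) x) p)) (proj₁ (f-spec x)) }
  where
  rearrange : ∀ {c} → ⌊ - - x √5⌋ᶻ < c + - x → x + ⌊ x √5⌋ᶻ < c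
  rearrange {c} t<c-x = begin-strict
    x + ⌊ x √5⌋ᶻ         ≡⟨ cong (λ y → x + ⌊ y √5⌋ᶻ) (ℤₚ.neg-involutive x) ⟨
    x + ⌊ - - x √5⌋ᶻ     <⟨ ℤₚ.+-monoʳ-< x t<c-x ⟩
    x + (c + - x)        ≡⟨ solve (x ∷ c ∷ []) ⟩
    c                    ∎
    where open ℤₚ.≤-Reasoning

·φ<ι-1+f : ∀ x → x ·φ <ᵩ ι (1ℤ + f x)
·φ<ι-1+f x = mk<ᵩ (subst Positive (sym (ι-⊖-·φ (1ℤ + f x) x))
  (subst (_< + 2 * (1ℤ + f x) + - x) (cong ⌊_√5⌋ᶻ (sym (ℤₚ.neg-involutive x)))
    (rearrange {f x} (proj₂ (f-spec x)))))
  where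
  rearrange : ∀ {c t} → x + t ≤ + 2 * c + 1ℤ → t < + 2 * (1ℤ + c) + - x
  rearrange {c} {t} x+t≤2c+1 = ℤₚ.suc[i]≤j⇒i<j (begin
    1ℤ + t                         ≡⟨ solve (x ∷ t ∷ []) ⟩
    (x + t) + (1ℤ + - x)           ≤⟨ ℤₚ.+-monoˡ-≤ (1ℤ + - x) x+t≤2c+1 ⟩
    (+ 2 * c + 1ℤ) + (1ℤ + - x)    ≡⟨ solve (c ∷ x ∷ []) ⟩
    + 2 * (1ℤ + c) + - x           ∎)
    where open ℤₚ.≤-Reasoning

ι-sandwich : ∀ {p q ξ} → ι p ≤ᵩ ξ → ξ <ᵩ ι (1ℤ + q) → p ≤ q
ι-sandwich {p} {q} {ξ} ιp≤ξ ξ<ι[1+q] = ℤₚ.≮⇒≥ λ q<p → <ᵩ-irrefl refl (begin-strict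
  ξ              <⟨ ξ<ι[1+q] ⟩
  ι (1ℤ + q)     ≤⟨ ι-mono-≤ (ℤₚ.i<j⇒suc[i]≤j q<p) ⟩
  ι p            ≤⟨ ιp≤ξ ⟩
  ξ              ∎)
  where open ≤ᵩ-Reasoning

ι≤·φ⇒≤f : ∀ {p x} → ι p ≤ᵩ x ·φ → p ≤ f x
ι≤·φ⇒≤f {x = x} ιp≤xφ = ι-sandwich ιp≤xφ (·φ<ι-1+f x)

f-unique : ∀ {x p} → ι p ≤ᵩ x ·φ → x ·φ <ᵩ ι (1ℤ + p) → f x ≡ p
f-unique {x} ιp≤xφ xφ<ι[1+p] = ℤₚ.≤-antisym (ι-sandwich (ι-f≤·φ x) xφ<ι[1+p]) (ι≤·φ⇒≤f ιp≤xφ)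

f-superadditive : ∀ w u → f w + f u ≤ f (w + u)
f-superadditive w u = ι≤·φ⇒≤f (⊕-mono-≤ᵩ (ι-f≤·φ w) (ι-f≤·φ u))

frac : ℤ → ℤ[φ]
frac x = x ·φ ⊖ ι (f x)

frac-⊖ : ∀ w u {v} → w + u ≡ v → frac v ⊖ frac u ≡ w ·φ ⊖ ι (f v - f u)
frac-⊖ w u refl = cong₂ _+φ_ (re-lemma (f (w + u)) (f u)) (im-lemma w u)
  where
  re-lemma : ∀ a b → 0ℤ + - a + - (0ℤ + - b) ≡ 0ℤ + - (a - b)
  re-lemma = solve-∀
  im-lemma : ∀ w u → w + u + - 0ℤ + - (u + - 0ℤ) ≡ w + - 0ℤ
  im-lemma = solve-∀

f-additive⇔frac≤ : ∀ w u {v} → w + u ≡ v → (f w + f u ≡ f v ⇔ frac u ≤ᵩ frac v)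
f-additive⇔frac≤ w u {v} w+u≡v = mk⇔ to from
  where
  a+b-b≡a : ∀ a b → a + b - b ≡ a
  a+b-b≡a = solve-∀
  a-b+b≡a : ∀ a b → a - b + b ≡ a
  a-b+b≡a = solve-∀
  to : f w + f u ≡ f v → frac u ≤ᵩ frac v
  to fw+fu≡fv =
    ≤ᵩ-⊖-cong (sym (frac-⊖ w u w+u≡v)) (subst (λ t → ι t ≤ᵩ w ·φ) (sym fv-fu≡fw) (ι-f≤·φ w))
    where
    fv-fu≡fw : f v - f u ≡ f w
    fv-fu≡fw = trans (cong (_- f u) (sym fw+fu≡fv)) (a+b-b≡a (f w) (f u))
  from : frac u ≤ᵩ frac v → f w + f u ≡ f v
  from fu≤fv = ℤₚ.≤-antisym (subst (f w + f u ≤_) (cong f w+u≡v) (f-superadditive w u)) (begin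
    f v                ≡⟨ a-b+b≡a (f v) (f u) ⟨
    f v - f u + f u
      ≤⟨ ℤₚ.+-monoˡ-≤ (f u) (ι≤·φ⇒≤f {f v - f u} {w} (≤ᵩ-⊖-cong (frac-⊖ w u w+u≡v) fu≤fv)) ⟩
    f w + f u          ∎)
    where open ℤₚ.≤-Reasoning

frac-char : ∀ x p {ξ} → x ·φ ⊖ ι p ≡ ξ → ι 0ℤ ≤ᵩ ξ → ξ <ᵩ ι 1ℤ → frac x ≡ ξ
frac-char x p refl 0≤ξ ξ<1 = cong (λ t → x ·φ ⊖ ι t) f[x]≡p
  where
  f[x]≡p : f x ≡ p
  f[x]≡p = f-unique {x} {p} (≤ᵩ-⊖-cong (⊖-identityʳ (x ·φ ⊖ ι p)) 0≤ξ)
                            (<ᵩ-⊖-cong (ι-⊖-⊖ι 1ℤ p (x ·φ)) ξ<1)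

frac-pair : ∀ x p {ξ} → x ·φ ⊖ ι p ≡ ξ → ι 0ℤ <ᵩ ξ → ξ <ᵩ ι 1ℤ →
            frac x ≡ ξ × frac (- x) ≡ ι 1ℤ ⊖ ξ
frac-pair x p {ξ} refl 0<ξ ξ<1 =
  frac-char x p refl (inj₁ 0<ξ) ξ<1 ,
  frac-char (- x) (- (1ℤ + p)) (neg-identity x p) (inj₁ (<ᵩ-⊖-cong (sym (⊖-identityʳ (ι 1ℤ ⊖ ξ))) ξ<1))
                               (<ᵩ-⊖-cong (trans (⊖-identityʳ ξ) (sym (η⊖[η⊖ξ]≡ξ (ι 1ℤ) ξ))) 0<ξ)
  where
  neg-identity : ∀ x p → (- x) ·φ ⊖ ι (- (1ℤ + p)) ≡ ι 1ℤ ⊖ (x ·φ ⊖ ι p)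
  neg-identity x p = cong₂ _+φ_ (re-lemma p) (im-lemma x)
    where
    re-lemma : ∀ p → 0ℤ + - - (1ℤ + p) ≡ 1ℤ + - (0ℤ + - p)
    re-lemma = solve-∀
    im-lemma : ∀ x → - x + - 0ℤ ≡ 0ℤ + - (x + - 0ℤ)
    im-lemma = solve-∀

infix 4 _<‖_φ‖

_<‖_φ‖ : ℤ[φ] → ℤ → Set
K <‖ x φ‖ = ∀ p → K <∣ x ·φ ⊖ ι p ∣

<‖φ‖-neg : ∀ {K} x → K <‖ x φ‖ → K <‖ - x φ‖
<‖φ‖-neg {K} x far p = subst (K <∣_∣) (cong₂ _+φ_ (re-lemma p) (im-lemma x)) (<∣⊖∣ (far (- p)))
  where
  re-lemma : ∀ p → - (0ℤ + - (- p)) ≡ 0ℤ + - p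
  re-lemma = solve-∀
  im-lemma : ∀ x → - (x + - 0ℤ) ≡ - x + - 0ℤ
  im-lemma = solve-∀

far⇒frac-bounds : ∀ {K} x → ι 0ℤ <ᵩ K → K <‖ x φ‖ → K <ᵩ frac x × frac x <ᵩ ι 1ℤ ⊖ K
far⇒frac-bounds {K} x 0<K far = lower (far (f x)) , upper (far (1ℤ + f x))
  where
  open ≤ᵩ-Reasoning
  lower : K <∣ frac x ∣ → K <ᵩ frac x
  lower (inj₁ K<frac) = K<frac
  lower (inj₂ K<⊖frac) = contradiction (begin-strict
    ι 0ℤ                <⟨ 0<K ⟩
    K                   <⟨ K<⊖frac ⟩
    ⊖ frac x            ≡⟨ ⊖[ξ⊖η]≡η⊖ξ (x ·φ) (ι (f x)) ⟩
    ι (f x) ⊖ x ·φ      ≤⟨ ≤ᵩ-⊖-cong (sym (ι0⊖[ξ⊖η]≡η⊖ξ (ι (f x)) (x ·φ))) (ι-f≤·φ x) ⟩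
    ι 0ℤ                ∎) (<ᵩ-irrefl refl)
  upper : K <∣ x ·φ ⊖ ι (1ℤ + f x) ∣ → frac x <ᵩ ι 1ℤ ⊖ K
  upper (inj₁ K<d) = contradiction (begin-strict
    ι 0ℤ                     <⟨ 0<K ⟩
    K                        <⟨ K<d ⟩
    x ·φ ⊖ ι (1ℤ + f x)
      <⟨ <ᵩ-⊖-cong (sym (ι0⊖[ξ⊖η]≡η⊖ξ (x ·φ) (ι (1ℤ + f x)))) (·φ<ι-1+f x) ⟩
    ι 0ℤ                     ∎) (<ᵩ-irrefl refl)
  upper (inj₂ K<⊖d) = <ᵩ-⊖-cong (identity K) K<⊖d
    where
    identity : ∀ K → ⊖ (x ·φ ⊖ ι (1ℤ + f x)) ⊖ K ≡ ι 1ℤ ⊖ K ⊖ frac x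
    identity (k +φ l) = cong₂ _+φ_ (re-lemma (f x) k) (im-lemma x l)
      where
      re-lemma : ∀ a k → - (0ℤ + - (1ℤ + a)) + - k ≡ 1ℤ + - k + - (0ℤ + - a)
      re-lemma = solve-∀
      im-lemma : ∀ x l → - (x + - 0ℤ) + - l ≡ 0ℤ + - l + - (x + - 0ℤ)
      im-lemma = solve-∀

-- Fibonacci numbers and best approximations

F : ℕ → ℤ
F n = + fib n

σ : ℕ → ℤ
σ zero    = 1ℤ
σ (suc k) = - σ k

σ-cases : ∀ k → σ k ≡ 1ℤ ⊎ σ k ≡ -1ℤ
σ-cases zero = inj₁ refl
σ-cases (suc k) with σ-cases k
... | inj₁ σk≡1  = inj₂ (cong -_ σk≡1)
... | inj₂ σk≡-1 = inj₁ (cong -_ σk≡-1)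

σ*σ≡1 : ∀ k → σ k * σ k ≡ 1ℤ
σ*σ≡1 k with σ-cases k
... | inj₁ σk≡1  rewrite σk≡1  = refl
... | inj₂ σk≡-1 rewrite σk≡-1 = refl

cassini : ∀ k → F k * F (suc (suc k)) - F (suc k) * F (suc k) ≡ σ k
cassini zero    = refl
cassini (suc k) = trans (step (F k) (F (suc k))) (cong -_ (cassini k))
  where
  step : ∀ a b → b * (b + (a + b)) - (a + b) * (a + b) ≡ - (a * (a + b) - b * b)
  step = solve-∀

fib-positive : ∀ n → 0 ℕ.< fib n
fib-positive zero          = s≤s z≤n
fib-positive (suc zero)    = s≤s z≤n
fib-positive (suc (suc n)) = ℕₚ.<-≤-trans (fib-positive n) (ℕₚ.m≤m+n (fib n) (fib (suc n)))

fib-mono : ∀ k → fib k ℕ.≤ fib (suc k)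
fib-mono zero    = ℕₚ.≤-refl
fib-mono (suc k) = ℕₚ.m≤n+m (fib (suc k)) (fib k)

fib-bracket : ∀ m → Σ ℕ λ k → fib k ℕ.≤ suc m × suc m ℕ.< fib (suc k)
fib-bracket zero = 1 , ℕₚ.≤-refl , s≤s (s≤s z≤n)
fib-bracket (suc m) with fib-bracket m
... | k , F≤1+m , 1+m<F′ with suc (suc m) ℕₚ.<? fib (suc k)
...   | yes 2+m<F′ = k , ℕₚ.m≤n⇒m≤1+n F≤1+m , 2+m<F′
...   | no  2+m≮F′ =
  suc k , ℕₚ.≮⇒≥ 2+m≮F′ , ℕₚ.≤-<-trans 1+m<F′ (ℕₚ.m<n+m (fib (suc k)) (fib-positive k))

δ : ℕ → ℤ[φ]
δ k = - F (suc k) +φ F k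

E : ℕ → ℤ[φ]
E k = σ k ⊛ δ k

E-rec : ∀ k → E k ≡ E (suc k) ⊕ E (suc (suc k))
E-rec k = cong₂ _+φ_ (re-lemma (σ k) (F k) (F (suc k))) (im-lemma (σ k) (F k) (F (suc k)))
  where
  re-lemma : ∀ s a b → s * - b ≡ - s * - (a + b) + - - s * - (b + (a + b))
  re-lemma = solve-∀
  im-lemma : ∀ s a b → s * a ≡ - s * b + - - s * (a + b)
  im-lemma = solve-∀

L : ℕ → ℤ
L k = + 2 * F (suc k) - F k

L-nonneg : ∀ k → 0ℤ ≤ L k
L-nonneg k = begin
  0ℤ                         ≤⟨ ℤₚ.+-mono-≤ (+≤+ z≤n) (ℤₚ.i≤j⇒0≤j-i (+≤+ (fib-mono k))) ⟩
  F (suc k) + (F (suc k) - F k)  ≡⟨ lemma (F (suc k)) (F k) ⟩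
  L k                        ∎
  where
  open ℤₚ.≤-Reasoning
  lemma : ∀ a b → a + (a - b) ≡ + 2 * a - b
  lemma = solve-∀

lucas-cassini : ∀ k → L k * L k + + 4 * σ k ≡ + 5 * (F k * F k)
lucas-cassini k = trans (cong (λ s → L k * L k + + 4 * s) (sym (cassini k))) (lemma (F k) (F (suc k)))
  where
  lemma : ∀ a b → (+ 2 * b - a) * (+ 2 * b - a) + + 4 * (a * (a + b) - b * b) ≡ + 5 * (a * a)
  lemma = solve-∀

-- 2 E k = σ k (F k √5 - L k), and 5 F k² - L k² = 4 σ k.
E-positive : ∀ k → ι 0ℤ <ᵩ E k
E-positive k = mk<ᵩ (subst Positive (sym (⊖-identityʳ (E k))) (positive-E (σ-cases k)))
  where
  open ℤₚ.≤-Reasoning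
  L² : ℤ
  L² = L k * L k
  positive-E : σ k ≡ 1ℤ ⊎ σ k ≡ -1ℤ → Positive (E k)
  positive-E (inj₁ σ≡1) = subst Positive (sym (trans (cong (_⊛ δ k) σ≡1) (⊛-identityˡ (δ k))))
    (positive-if-sq< { - F (suc k)} {fib k} (lemma (F (suc k)) (F k)) (L-nonneg k) (begin-strict
      L²                   ≡⟨ ℤₚ.+-identityʳ L² ⟨
      L² + 0ℤ              <⟨ ℤₚ.+-monoʳ-< L² (+<+ (s≤s z≤n)) ⟩
      L² + + 4 * 1ℤ        ≡⟨ cong (λ s → L² + + 4 * s) σ≡1 ⟨
      L² + + 4 * σ k       ≡⟨ lucas-cassini k ⟩
      + 5 * (F k * F k)    ∎))
    where
    lemma : ∀ b a → + 2 * - b + a ≡ - (+ 2 * b - a)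
    lemma = solve-∀
  positive-E (inj₂ σ≡-1) = subst Positive (sym (trans (cong (_⊛ δ k) σ≡-1) (-1⊛ξ≡⊖ξ (δ k))))
    (positive-if-5sq< { - - F (suc k)} {fib k} (lemma (F (suc k)) (F k)) (L-nonneg k) (begin-strict
      + 5 * (F k * F k)    ≡⟨ lucas-cassini k ⟨
      L² + + 4 * σ k       ≡⟨ cong (λ s → L² + + 4 * s) σ≡-1 ⟩
      L² + + 4 * -1ℤ       <⟨ ℤₚ.+-monoʳ-< L² -<+ ⟩
      L² + 0ℤ              ≡⟨ ℤₚ.+-identityʳ L² ⟩
      L²                   ∎))
    where
    lemma : ∀ b a → + 2 * - - b + - a ≡ + 2 * b - a
    lemma = solve-∀

E-decreasing : ∀ k → E (suc k) <ᵩ E k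
E-decreasing k = <ᵩ-⊖-cong E[k+2]⊖0≡E[k]⊖E[k+1] (E-positive (suc (suc k)))
  where
  E[k+2]⊖0≡E[k]⊖E[k+1] : E (suc (suc k)) ⊖ ι 0ℤ ≡ E k ⊖ E (suc k)
  E[k+2]⊖0≡E[k]⊖E[k+1] = begin
    E (suc (suc k)) ⊖ ι 0ℤ                   ≡⟨ ⊖-identityʳ (E (suc (suc k))) ⟩
    E (suc (suc k))                          ≡⟨ [η⊕ξ]⊖η≡ξ (E (suc k)) (E (suc (suc k))) ⟨
    (E (suc k) ⊕ E (suc (suc k))) ⊖ E (suc k) ≡⟨ cong (_⊖ E (suc k)) (E-rec k) ⟨
    E k ⊖ E (suc k)                          ∎
    where open ≡-Reasoning

E<1 : ∀ k → E k <ᵩ ι 1ℤ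
E<1 zero    = <ᵩ-⊖-cong refl (E-positive 1)
E<1 (suc k) = <ᵩ-trans (E-decreasing k) (E<1 k)

unimodular-basis : ∀ a b c {ε} → a * c - b * b ≡ ε → ε * ε ≡ 1ℤ →
                   ∀ q p → ∃₂ λ α β → q ≡ α * a + β * b × p ≡ α * b + β * c
unimodular-basis a b c {ε} det≡ε ε²≡1 q p =
  ε * (q * c - p * b) , ε * (p * a - q * b) , trans (unit q) (q-lemma ε a b c q p) , trans (unit p) (p-lemma ε a b c q p)
  where
  open ≡-Reasoning
  unit : ∀ t → t ≡ ε * ((a * c - b * b) * t)
  unit t = begin
    t                          ≡⟨ ℤₚ.*-identityˡ t ⟨
    1ℤ * t                     ≡⟨ cong (_* t) ε²≡1 ⟨
    ε * ε * t                  ≡⟨ cong (λ d → ε * d * t) det≡ε ⟨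
    ε * (a * c - b * b) * t    ≡⟨ ℤₚ.*-assoc ε (a * c - b * b) t ⟩
    ε * ((a * c - b * b) * t)  ∎
  q-lemma : ∀ ε a b c q p → ε * ((a * c - b * b) * q) ≡ ε * (q * c - p * b) * a + ε * (p * a - q * b) * b
  q-lemma = solve-∀
  p-lemma : ∀ ε a b c q p → ε * ((a * c - b * b) * p) ≡ ε * (q * c - p * b) * b + ε * (p * a - q * b) * c
  p-lemma = solve-∀

nonpos-sum : ∀ {x y} α β → α ≤ 0ℤ → β ≤ 0ℤ → α * + x + β * + y ≤ 0ℤ
nonpos-sum {x} {y} α β α≤0 β≤0 = ℤₚ.+-mono-≤
  (subst (α * + x ≤_) (ℤₚ.*-zeroˡ (+ x)) (ℤₚ.*-monoʳ-≤-nonNeg (+ x) α≤0))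
  (subst (β * + y ≤_) (ℤₚ.*-zeroˡ (+ y)) (ℤₚ.*-monoʳ-≤-nonNeg (+ y) β≤0))

data SignPattern : ℤ → ℤ → Set where
  pos-nonpos : ∀ m n → SignPattern +[1+ m ] (- + n)
  neg-pos    : ∀ m n → SignPattern -[1+ m ] +[1+ n ]
  zero-one   : SignPattern 0ℤ 1ℤ

sign-pattern : ∀ {x y} α β → x ℕ.≤ y → 0ℤ < α * + x + β * + y → α * + x + β * + y < + x + + y →
               SignPattern α β
sign-pattern +[1+ m ] +0           _   _   _     = pos-nonpos m 0
sign-pattern +[1+ m ] -[1+ n ]     _   _   _     = pos-nonpos m (suc n)
sign-pattern -[1+ m ] +[1+ n ]     _   _   _     = neg-pos m n
sign-pattern +0       +[1+ 0 ]     _   _   _     = zero-one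
sign-pattern {x} {y} +0 +[1+ suc n ] x≤y _ s<x+y = contradiction s<x+y (ℤₚ.≤⇒≯ (begin
  + (x ℕ.+ y)                        ≤⟨ +≤+ (ℕₚ.+-mono-≤ x≤y (ℕₚ.m≤m+n y (n ℕ.* y))) ⟩
  + (suc (suc n) ℕ.* y)               ≡⟨ ℤₚ.pos-* (suc (suc n)) y ⟩
  +[1+ suc n ] * + y                  ≡⟨ ℤₚ.+-identityˡ (+[1+ suc n ] * + y) ⟨
  +0 * + x + +[1+ suc n ] * + y       ∎))
  where open ℤₚ.≤-Reasoning
sign-pattern {x} {y} +[1+ m ] +[1+ n ] _ _ s<x+y =
  contradiction s<x+y (ℤₚ.≤⇒≯ (ℤₚ.+-mono-≤ (≤+[1+m]* m x) (≤+[1+m]* n y)))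
  where
  ≤+[1+m]* : ∀ m x → + x ≤ +[1+ m ] * + x
  ≤+[1+m]* m x = subst (+ x ≤_) (ℤₚ.pos-* (suc m) x) (+≤+ (ℕₚ.m≤m+n x (m ℕ.* x)))
sign-pattern {x} {y} α@(+0)       β@(+0)       _ 0<s _ =
  contradiction 0<s (ℤₚ.≤⇒≯ (nonpos-sum {x} {y} α β ℤₚ.≤-refl ℤₚ.≤-refl))
sign-pattern {x} {y} α@(+0)       β@(-[1+ _ ]) _ 0<s _ =
  contradiction 0<s (ℤₚ.≤⇒≯ (nonpos-sum {x} {y} α β ℤₚ.≤-refl -≤+))
sign-pattern {x} {y} α@(-[1+ _ ]) β@(+0)       _ 0<s _ =
  contradiction 0<s (ℤₚ.≤⇒≯ (nonpos-sum {x} {y} α β -≤+ ℤₚ.≤-refl))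
sign-pattern {x} {y} α@(-[1+ _ ]) β@(-[1+ _ ]) _ 0<s _ =
  contradiction 0<s (ℤₚ.≤⇒≯ (nonpos-sum {x} {y} α β -≤+ -≤+))

far-combination : ∀ {A B α β} → ι 0ℤ <ᵩ B → B <ᵩ A → SignPattern α β → ¬ (α ≡ 0ℤ × β ≡ 1ℤ) →
                  B <∣ α ⊛ A ⊖ β ⊛ B ∣
far-combination {A} {B} 0<B B<A (pos-nonpos m n) _ = inj₁ (begin-strict
  B                             <⟨ B<A ⟩
  A                             ≤⟨ ≤ᵩ-⊖-cong (identity A B) (⊕-mono-≤ᵩ (0≤ᵩ+n⊛ m 0<A) (0≤ᵩ+n⊛ n 0<B)) ⟩
  +[1+ m ] ⊛ A ⊖ (- + n) ⊛ B    ∎)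
  where
  open ≤ᵩ-Reasoning
  0<A : ι 0ℤ <ᵩ A
  0<A = <ᵩ-trans 0<B B<A
  identity : ∀ A B → + m ⊛ A ⊕ + n ⊛ B ⊖ ι 0ℤ ≡ +[1+ m ] ⊛ A ⊖ (- + n) ⊛ B ⊖ A
  identity (a +φ b) (c +φ d) = cong₂ _+φ_ (lemma (+ m) (+ n) a c) (lemma (+ m) (+ n) b d)
    where
    lemma : ∀ m n a c → m * a + n * c + - 0ℤ ≡ (1ℤ + m) * a + - (- n * c) + - a
    lemma = solve-∀
far-combination {A} {B} 0<B B<A (neg-pos m n) _ = inj₂ (begin-strict
  B                             <⟨ B<A ⟩
  A                             ≤⟨ ≤ᵩ-⊖-cong (identity A B) (⊕-mono-≤ᵩ (0≤ᵩ+n⊛ m 0<A) (0≤ᵩ+n⊛ (suc n) 0<B)) ⟩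
  ⊖ (-[1+ m ] ⊛ A ⊖ +[1+ n ] ⊛ B) ∎)
  where
  open ≤ᵩ-Reasoning
  0<A : ι 0ℤ <ᵩ A
  0<A = <ᵩ-trans 0<B B<A
  identity : ∀ A B → + m ⊛ A ⊕ +[1+ n ] ⊛ B ⊖ ι 0ℤ ≡ ⊖ (-[1+ m ] ⊛ A ⊖ +[1+ n ] ⊛ B) ⊖ A
  identity (a +φ b) (c +φ d) = cong₂ _+φ_ (lemma (+ m) (+ n) a c) (lemma (+ m) (+ n) b d)
    where
    lemma : ∀ m n a c → m * a + (1ℤ + n) * c + - 0ℤ ≡ - (- (1ℤ + m) * a + - ((1ℤ + n) * c)) + - a
    lemma = solve-∀
far-combination _ _ zero-one ¬01 = contradiction (refl , refl) ¬01

<∣σ⊛∣ : ∀ {K ξ} k → K <∣ ξ ∣ → K <∣ σ k ⊛ ξ ∣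
<∣σ⊛∣ {K} {ξ} k K<∣ξ∣ with σ-cases k
... | inj₁ σ≡1  =
  subst (λ s → K <∣ s ⊛ ξ ∣) (sym σ≡1) (subst (K <∣_∣) (sym (⊛-identityˡ ξ)) K<∣ξ∣)
... | inj₂ σ≡-1 =
  subst (λ s → K <∣ s ⊛ ξ ∣) (sym σ≡-1) (subst (K <∣_∣) (sym (-1⊛ξ≡⊖ξ ξ)) (<∣⊖∣ K<∣ξ∣))

-- δ j = σ j ⊛ E j and δ (suc j) = ⊖ (σ j ⊛ E (suc j)), since σ j * σ j = 1.
lattice-point : ∀ j α β → (α * F j + β * F (suc j)) ·φ ⊖ ι (α * F (suc j) + β * F (suc (suc j)))
                          ≡ σ j ⊛ (α ⊛ E j ⊖ β ⊛ E (suc j))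
lattice-point j α β = cong₂ _+φ_
  (sym (trans (re-lemma (σ j) α β (F (suc j)) (F (suc (suc j)))) (σ²* _)))
  (sym (trans (im-lemma (σ j) α β (F j) (F (suc j))) (σ²* _)))
  where
  σ²* : ∀ t → σ j * σ j * t ≡ t
  σ²* t = trans (cong (_* t) (σ*σ≡1 j)) (ℤₚ.*-identityˡ t)
  re-lemma : ∀ s α β y z → s * (α * (s * - y) + - (β * (- s * - z))) ≡ s * s * (0ℤ + - (α * y + β * z))
  re-lemma = solve-∀
  im-lemma : ∀ s α β x y → s * (α * (s * x) + - (β * (- s * y))) ≡ s * s * (α * x + β * y + - 0ℤ)
  im-lemma = solve-∀

best-approximation : ∀ j q p → 0ℤ < q → q < F (suc (suc j)) → ¬ (q ≡ F (suc j) × p ≡ F (suc (suc j))) →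
                     E (suc j) <∣ q ·φ ⊖ ι p ∣
best-approximation j q p 0<q q<F ¬special with unimodular-basis (F j) (F (suc j)) (F (suc (suc j))) (cassini j) (σ*σ≡1 j) q p
... | α , β , refl , refl =
  subst (E (suc j) <∣_∣) (sym (lattice-point j α β))
    (<∣σ⊛∣ j (far-combination (E-positive (suc j)) (E-decreasing j) (sign-pattern α β (fib-mono j) 0<q q<F) ¬01))
  where
  0*a+1*b≡b : ∀ a b → 0ℤ * a + 1ℤ * b ≡ b
  0*a+1*b≡b a b = trans (ℤₚ.+-identityˡ (1ℤ * b)) (ℤₚ.*-identityˡ b)
  ¬01 : ¬ (α ≡ 0ℤ × β ≡ 1ℤ)
  ¬01 (refl , refl) = ¬special (0*a+1*b≡b (F j) (F (suc j)) , 0*a+1*b≡b (F (suc j)) (F (suc (suc j))))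

σF-fracs : ∀ k → frac (σ k * F k) ≡ E k × frac (- (σ k * F k)) ≡ ι 1ℤ ⊖ E k
σF-fracs k = frac-pair (σ k * F k) (σ k * F (suc k)) (cong₂ _+φ_ (re-lemma (σ k) (F (suc k))) (im-lemma (σ k) (F k)))
                       (E-positive k) (E<1 k)
  where
  re-lemma : ∀ s b → 0ℤ + - (s * b) ≡ s * - b
  re-lemma = solve-∀
  im-lemma : ∀ s a → s * a + - 0ℤ ≡ s * a
  im-lemma = solve-∀

fracs-F : ∀ k → (frac (F k) ≡ E k × frac (- F k) ≡ ι 1ℤ ⊖ E k)
              ⊎ (frac (F k) ≡ ι 1ℤ ⊖ E k × frac (- F k) ≡ E k)
fracs-F k = Sum.map (λ σ≡1  → subst Fracs (trans (cong (_* F k) σ≡1) (ℤₚ.*-identityˡ (F k))) (σF-fracs k))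
                    (λ σ≡-1 → swap (subst Fracs (trans (cong (_* F k) σ≡-1) (ℤₚ.-1*i≡-i (F k))) (σF-fracs k)))
                    (σ-cases k)
  where
  Fracs : ℤ → Set
  Fracs x = frac x ≡ E k × frac (- x) ≡ ι 1ℤ ⊖ E k
  swap : Fracs (- F k) → frac (F k) ≡ ι 1ℤ ⊖ E k × frac (- F k) ≡ E k
  swap (frac[-F]≡E , frac[--F]≡1-E) =
    subst (λ x → frac x ≡ ι 1ℤ ⊖ E k) (ℤₚ.neg-involutive (F k)) frac[--F]≡1-E , frac[-F]≡E

far-below-F : ∀ j y → 0ℤ < y → y < F (suc j) → E (suc j) <‖ y φ‖
far-below-F j y 0<y y<F p =
  best-approximation j y p 0<y (ℤₚ.<-≤-trans y<F (+≤+ (fib-mono (suc j)))) (λ (y≡F , _) → ℤₚ.<-irrefl y≡F y<F)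

Between : ℤ[φ] → ℤ[φ] → ℤ[φ] → Set
Between ξ η ζ = (ξ ≤ᵩ η × η ≤ᵩ ζ) ⊎ (ζ ≤ᵩ η × η ≤ᵩ ξ)

between-of-bounds : ∀ {K a b c} → K <ᵩ b × b <ᵩ ι 1ℤ ⊖ K →
                    (a ≡ K × c ≡ ι 1ℤ ⊖ K) ⊎ (a ≡ ι 1ℤ ⊖ K × c ≡ K) → Between a b c
between-of-bounds (K<b , b<1-K) (inj₁ (refl , refl)) = inj₁ (inj₁ K<b , inj₁ b<1-K)
between-of-bounds (K<b , b<1-K) (inj₂ (refl , refl)) = inj₂ (inj₁ K<b , inj₁ b<1-K)

¬between-of-bounds : ∀ {K a b c} → K <ᵩ a × a <ᵩ ι 1ℤ ⊖ K → K <ᵩ c × c <ᵩ ι 1ℤ ⊖ K →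
                     b ≡ K ⊎ b ≡ ι 1ℤ ⊖ K → ¬ Between a b c
¬between-of-bounds (K<a , _)     _             (inj₁ refl) (inj₁ (a≤K , _))   = <ᵩ⇒≱ᵩ K<a a≤K
¬between-of-bounds _             (K<c , _)     (inj₁ refl) (inj₂ (c≤K , _))   = <ᵩ⇒≱ᵩ K<c c≤K
¬between-of-bounds _             (_ , c<1-K)   (inj₂ refl) (inj₁ (_ , 1-K≤c)) = <ᵩ⇒≱ᵩ c<1-K 1-K≤c
¬between-of-bounds (_ , a<1-K)   _             (inj₂ refl) (inj₂ (_ , 1-K≤a)) = <ᵩ⇒≱ᵩ a<1-K 1-K≤a

between-F : ∀ j y → 0ℤ < y → y < F (suc j) → Between (frac (F (suc j))) (frac y) (frac (- F (suc j)))
between-F j y 0<y y<F =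
  between-of-bounds (far⇒frac-bounds y (E-positive (suc j)) (far-below-F j y 0<y y<F)) (fracs-F (suc j))

¬between-nonF : ∀ j z → F (suc j) < z → z < F (suc (suc j)) → ¬ Between (frac z) (frac (F (suc j))) (frac (- z))
¬between-nonF j z F<z z<F′ = ¬between-of-bounds
  (far⇒frac-bounds z (E-positive (suc j)) far) (far⇒frac-bounds (- z) (E-positive (suc j)) (<‖φ‖-neg z far))
  (Sum.map proj₁ proj₁ (fracs-F (suc j)))
  where
  far : E (suc j) <‖ z φ‖
  far p = best-approximation j z p (ℤₚ.<-trans (+<+ (fib-positive (suc j))) F<z) z<F′
                             (λ (z≡F , _) → ℤₚ.<-irrefl (sym z≡F) F<z)

-- The defining formula

x′≡-x : ∀ {x x′} → x + x′ ≡ 0ℤ → x′ ≡ - x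
x′≡-x {x} {x′} = ℤ-group.inverseʳ-unique x x′

fibMatrix : Formula 4
fibMatrix =
  (zer ≺ x) ∧ᶠ
  (((plus x x′ ≐ zer) ∧ᶠ ((plus y y′ ≐ zer) ∧ᶠ ((zer ≺ y) ∧ᶠ (y ≺ x)))) ⇒ᶠ
   (((plus (fₜ (plus y x′)) (fₜ x) ≐ fₜ y) ∧ᶠ (plus (fₜ (plus x′ y′)) (fₜ y) ≐ fₜ x′)) ∨ᶠ
    ((plus (fₜ (plus x y)) (fₜ x′) ≐ fₜ y) ∧ᶠ (plus (fₜ (plus x y′)) (fₜ y) ≐ fₜ x))))
  where
  x y x′ y′ : Term 4
  x  = var (Fin.suc (Fin.suc (Fin.suc Fin.zero)))
  y  = var (Fin.suc (Fin.suc Fin.zero))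
  x′ = var (Fin.suc Fin.zero)
  y′ = var Fin.zero

fibMatrix-qf : QF fibMatrix
fibMatrix-qf =
  qf-and (qf-lt _ _)
    (qf-imp (qf-and (qf-eq _ _) (qf-and (qf-eq _ _) (qf-and (qf-lt _ _) (qf-lt _ _))))
            (qf-or (qf-and (qf-eq _ _) (qf-eq _ _)) (qf-and (qf-eq _ _) (qf-eq _ _))))

fibFormula : Formula 1
fibFormula = all (all (all fibMatrix))

Conclusion : ℤ → ℤ → ℤ → ℤ → Set
Conclusion x y x′ y′ = (f (y + x′) + f x ≡ f y × f (x′ + y′) + f y ≡ f x′)
                     ⊎ (f (x + y) + f x′ ≡ f y × f (x + y′) + f y ≡ f x)

-- ⟦ fibMatrix ⟧ (y′ ∷ x′ ∷ y ∷ x ∷ _) unfolds to Matrix x y x′ y′.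
Matrix : ℤ → ℤ → ℤ → ℤ → Set
Matrix x y x′ y′ = 0ℤ < x × (x + x′ ≡ 0ℤ × y + y′ ≡ 0ℤ × 0ℤ < y × y < x → Conclusion x y x′ y′)

conclusion⇔between : ∀ x y → Conclusion x y (- x) (- y) ⇔ Between (frac x) (frac y) (frac (- x))
conclusion⇔between x y =
  (f-additive⇔frac≤ (y - x) x (lemma₁ y x) ×-⇔ f-additive⇔frac≤ (- x - y) y (lemma₁ (- x) y))
  ⊎-⇔ (f-additive⇔frac≤ (x + y) (- x) (lemma₂ x y) ×-⇔ f-additive⇔frac≤ (x - y) y (lemma₁ x y))
  where
  lemma₁ : ∀ a b → a - b + b ≡ a
  lemma₁ = solve-∀
  lemma₂ : ∀ a b → a + b + - a ≡ b
  lemma₂ = solve-∀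

F-satisfies : ∀ n y x′ y′ → Matrix (F n) y x′ y′
F-satisfies zero    y x′ y′ = +<+ (fib-positive zero) ,
  λ (_ , _ , 0<y , y<1) → contradiction y<1 (ℤₚ.≤⇒≯ (ℤₚ.i<j⇒suc[i]≤j 0<y))
F-satisfies (suc j) y x′ y′ = +<+ (fib-positive (suc j)) ,
  λ (x+x′≡0 , y+y′≡0 , 0<y , y<x) →
    subst₂ (Conclusion (F (suc j)) y) (sym (x′≡-x x+x′≡0)) (sym (x′≡-x y+y′≡0))
      (Equivalence.from (conclusion⇔between (F (suc j)) y) (between-F j y 0<y y<x))

satisfies⇒IsFib : ∀ z → (∀ y x′ y′ → Matrix z y x′ y′) → IsFib z
satisfies⇒IsFib (+ zero)  sat = contradiction (proj₁ (sat 0ℤ 0ℤ 0ℤ)) (ℤₚ.<-irrefl refl)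
satisfies⇒IsFib -[1+ _ ]  sat = contradiction (proj₁ (sat 0ℤ 0ℤ 0ℤ)) λ ()
satisfies⇒IsFib (+ suc m) sat with fib-bracket m
... | zero  , _ , s≤s ()
... | suc j , F≤z , z<F′ with fib (suc j) ℕ.≟ suc m
...   | yes F≡z = suc j , cong +_ (sym F≡z)
...   | no  F≢z = contradiction
  (Equivalence.to (conclusion⇔between z y)
    (proj₂ (sat y (- z) (- y)) (ℤₚ.+-inverseʳ z , ℤₚ.+-inverseʳ y , +<+ (fib-positive (suc j)) , F<z)))
  (¬between-nonF j z F<z (+<+ z<F′))
  where
  z y : ℤ
  z = + suc m
  y = F (suc j)
  F<z : F (suc j) < z
  F<z = +<+ (ℕₚ.≤∧≢⇒< F≤z F≢z)

corollary3p3 : Π₁-Definable IsFib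
corollary3p3 =
  fibFormula , π-all (π-all (π-all (π-qf fibMatrix-qf))) ,
  λ z → satisfies⇒IsFib z , λ { (n , refl) → F-satisfies n }
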